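{- Let $k\ge 1$ and $\ell$ be integers with $0\le \ell\le 2k-1$. Let $G=(V,E)$ be a multigraph (loops allowed) on $n$ vertices with $kn-\ell$ edges. The following statements are equivalent: (1) $G$ is $(k,0)$-sparse; (2) there is some set of $\ell$ edges which, when added to $G$, results in a $k$-map.
   Context: Graphs are multigraphs, possibly with loops. A graph on $n$ vertices is $(k,\ell)$-sparse if no subset $V'$ of $n'$ vertices spans more than $kn'-\ell$ edges (edges with both endpoints in $V'$, loops included). A map is a graph on vertex set $V$ that admits an orientation of its edges so that every vertex has out-degree exactly $1$ (a loop contributes out-degree 1 to its vertex). A $k$-map is a graph whose edge set can be decomposed into $k$ edge-disjoint maps on the same vertex set. -}

module Defs where

open import Data.Nat using (ℕ; zero; suc; _+_; _*_; _≤_)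
open import Data.Bool using (Bool; true; false; if_then_else_; _∧_)
open import Data.Fin using (Fin; zero; suc; splitAt; _≟_)
open import Data.Fin.Subset using (Subset; ∣_∣)
open import Data.Vec using (lookup)
open import Data.Product using (_×_; _,_; proj₁; proj₂; ∃)
open import Data.Sum using ([_,_])
open import Relation.Nullary.Decidable using (⌊_⌋)
open import Relation.Binary.PropositionalEquality using (_≡_)

-- A multigraph (loops allowed) on vertex set Fin n with m labelled edges;
-- edge e has endpoints G e = (u , v)  (a loop when u = v).
Graph : ℕ → ℕ → Set
Graph n m = Fin m → Fin n × Fin n

count : ∀ {m} → (Fin m → Bool) → ℕ
count {zero}  p = 0
count {suc m} p = (if p zero then 1 else 0) + count (λ i → p (suc i))

spanned : ∀ {n m} → Graph n m → Subset n → ℕ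
spanned G V' = count (λ e → lookup V' (proj₁ (G e)) ∧ lookup V' (proj₂ (G e)))

-- (k,ℓ)-sparse: every V' with n' vertices spans at most k n' - ℓ edges.
-- Stated as  spanned + ℓ ≤ k n'  (avoids truncated subtraction).
Sparse : ℕ → ℕ → ∀ {n m} → Graph n m → Set
Sparse k ℓ {n} G = (V' : Subset n) → spanned G V' + ℓ ≤ k * ∣ V' ∣

-- an orientation: o e = true means edge e is oriented proj₁ → proj₂,
-- false means proj₂ → proj₁. The tail is the vertex the edge leaves.
Orientation : ℕ → Set
Orientation m = Fin m → Bool

tail : ∀ {n m} → Graph n m → Orientation m → Fin m → Fin n
tail G o e = if o e then proj₁ (G e) else proj₂ (G e)

-- The spanning subgraph of G with edge set S (S e = true iff e ∈ S) is a map: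
-- some orientation gives every vertex out-degree exactly 1.
IsMapOn : ∀ {n m} → Graph n m → (Fin m → Bool) → Set
IsMapOn {n} {m} G S =
  ∃ λ (o : Orientation m) → (v : Fin n) →
    count (λ e → S e ∧ ⌊ tail G o e ≟ v ⌋) ≡ 1

IsMap : ∀ {n m} → Graph n m → Set
IsMap G = IsMapOn G (λ _ → true)

-- k-map: the edge set decomposes into k edge-disjoint maps
-- (c assigns each edge to one of the k parts).
IsKMap : ℕ → ∀ {n m} → Graph n m → Set
IsKMap k {n} {m} G =
  ∃ λ (c : Fin m → Fin k) → (i : Fin k) → IsMapOn G (λ e → ⌊ c e ≟ i ⌋)

addEdges : ∀ {n m ℓ} → Graph n m → Graph n ℓ → Graph n (m + ℓ)
addEdges {m = m} G H e = [ G , H ] (splitAt m e)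

-- Think of every vertex as owning k slots (v , i). An edge placed in a slot at one of its
-- endpoints is oriented out of v and given colour i; if no slot receives two edges, all
-- out-degrees are at most k, and if every slot is used, colour class i is a map for each i.
-- Such a placement exists as soon as no vertex set spans more edges than it owns slots
-- (Hall's condition). By induction on the edges: put the first edge uw in a free slot at u or
-- at w, unless that breaks the condition for the remaining edges. If it does at both, there are
-- tight sets A ∋ u and B ∋ w for the remaining edges; spanned edges are supermodular and slots
-- are modular, so A ∪ B is tight too, yet it also spans uw, contradicting Hall's condition.
--
-- A (k,0)-sparse G therefore has an orientation with out-degrees at most k. Adding ℓ = kn − m
-- loops at vertices of out-degree below k keeps this property, hence keeps sparsity, and gives
-- exactly kn edges, so every slot gets used: the result is a k-map. Conversely, every edge
-- spanned by V' has its tail in V', so a k-map, and with it G, spans at most k|V'| edges on V'.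

module Submission where

open import Defs
open import Data.Nat using (ℕ; zero; suc; _+_; _*_; _≤_; _<_; z≤n; z<s; _<?_)
open import Data.Nat.Properties
  using (+-0-commutativeMonoid; +-assoc; +-comm; +-identityʳ; *-suc; *-zeroʳ; *-identityʳ; *-comm;
         ≤-refl; ≤-reflexive; ≤-trans; ≤-antisym; +-mono-≤; +-monoʳ-≤; +-cancelʳ-≤;
         +-monoˡ-≤; m≤m+n; m≤n+m; m<m+n; <-≤-trans; +-suc; <⇒≱; ≮⇒≥; ≤ᵇ⇒≤; module ≤-Reasoning)
open import Data.Bool using (Bool; true; false; if_then_else_; _∧_; _∨_; not)
open import Data.Bool.Properties using (∧-identityʳ; ∧-zeroʳ)
open import Data.Unit using (tt)
open import Data.Empty using (⊥-elim) renaming (⊥ to Empty)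
open import Data.Fin using (Fin; zero; suc; _≟_; _↑ˡ_; _↑ʳ_)
open import Data.Fin.Properties using (splitAt-↑ˡ; splitAt-↑ʳ; any?)
open import Data.Fin.Subset using (Subset; ∣_∣; _∪_; _∩_; ⁅_⁆; ⊥; _∈_)
open import Data.Fin.Subset.Properties using (anySubset?; x∈⁅x⁆; x∈p∪q⁺)
open import Data.Vec using ([]; _∷_; lookup)
open import Data.Vec.Properties using (lookup-zipWith; []=⇒lookup; lookup⇒[]=)
open import Data.Vec.Functional as Vector using (_++_; removeAt)
open import Data.Product using (_×_; _,_; proj₁; proj₂; ∃; Σ)
open import Data.Sum using (_⊎_; inj₁; inj₂)
open import Function using (_∘_)
open import Relation.Nullary using (yes; no)
open import Relation.Nullary.Decidable using (⌊_⌋)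
open import Relation.Binary.PropositionalEquality
  using (_≡_; refl; sym; trans; cong; cong₂; subst; module ≡-Reasoning)
open import Function.Bundles using (_⇔_; mk⇔)
open import Algebra.Properties.CommutativeMonoid.Sum +-0-commutativeMonoid
  using (sum; sum-cong-≗; ∑-distrib-+; sum-remove)

-- Counting and finite sums

𝟙 : Bool → ℕ
𝟙 b = if b then 1 else 0

count-as-sum : ∀ {N} (p : Fin N → Bool) → count p ≡ sum (λ i → 𝟙 (p i))
count-as-sum {zero}  p = refl
count-as-sum {suc N} p = cong (𝟙 (p zero) +_) (count-as-sum (p ∘ suc))

count-cong : ∀ {N} {p q : Fin N → Bool} → (∀ i → p i ≡ q i) → count p ≡ count q
count-cong {N} {p} {q} p≗q = begin
  count p                ≡⟨ count-as-sum p ⟩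
  sum (λ i → 𝟙 (p i)) ≡⟨ sum-cong-≗ (cong 𝟙 ∘ p≗q) ⟩
  sum (λ i → 𝟙 (q i)) ≡⟨ count-as-sum q ⟨
  count q                ∎
  where open ≡-Reasoning

count-split : ∀ m {ℓ} (p : Fin (m + ℓ) → Bool) →
  count p ≡ count (λ i → p (i ↑ˡ ℓ)) + count (λ j → p (m ↑ʳ j))
count-split zero    p = refl
count-split (suc m) p = trans (cong (𝟙 (p zero) +_) (count-split m (p ∘ suc))) (sym (+-assoc (𝟙 (p zero)) _ _))

count≡0⊎∃ : ∀ {N} (p : Fin N → Bool) → count p ≡ 0 ⊎ ∃ λ i → p i ≡ true
count≡0⊎∃ {zero}  p = inj₁ refl
count≡0⊎∃ {suc N} p with p zero in p₀ | count≡0⊎∃ (p ∘ suc)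
... | true  | _              = inj₂ (zero , p₀)
... | false | inj₁ count≡0   = inj₁ count≡0
... | false | inj₂ (i , pᵢ)  = inj₂ (suc i , pᵢ)

sum-const : ∀ N x → sum {N} (λ _ → x) ≡ N * x
sum-const zero    x = refl
sum-const (suc N) x = cong (x +_) (sum-const N x)

sum-mono-≤ : ∀ {N} {f g : Fin N → ℕ} → (∀ i → f i ≤ g i) → sum f ≤ sum g
sum-mono-≤ {zero}  f≤g = z≤n
sum-mono-≤ {suc N} f≤g = +-mono-≤ (f≤g zero) (sum-mono-≤ (f≤g ∘ suc))

sum-bounded : ∀ {N} (f : Fin N → ℕ) {b} → (∀ i → f i ≤ b) → sum f ≤ N * b
sum-bounded {N} f {b} f≤b = ≤-trans (sum-mono-≤ f≤b) (≤-reflexive (sum-const N b))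

sum-saturated : ∀ {N} (f : Fin N → ℕ) {b} → (∀ i → f i ≤ b) → N * b ≤ sum f → ∀ i → f i ≡ b
sum-saturated {suc N} f {b} f≤b N*b≤sum i = ≤-antisym (f≤b i) (+-cancelʳ-≤ (N * b) b (f i) (begin
  b + N * b                   ≤⟨ N*b≤sum ⟩
  sum f                       ≡⟨ sum-remove f ⟩
  f i + sum (removeAt f i)    ≤⟨ +-monoʳ-≤ (f i) (sum-bounded (removeAt f i) (λ _ → f≤b _)) ⟩
  f i + N * b                 ∎))
  where open ≤-Reasoning

-- ⌊_⌋ is isYes, which does not compute on the map′ returned by suc x ≟ suc y.
isYes-suc≟suc : ∀ {N} (x y : Fin N) → ⌊ suc x ≟ suc y ⌋ ≡ ⌊ x ≟ y ⌋
isYes-suc≟suc x y with x ≟ y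
... | yes _ = refl
... | no _  = refl

sum-pick : ∀ {N} (x : Fin N) (b : Fin N → Bool) → sum (λ i → 𝟙 (⌊ x ≟ i ⌋ ∧ b i)) ≡ 𝟙 (b x)
sum-pick {suc N} zero    b =
  trans (cong (𝟙 (b zero) +_) (trans (sum-const N 0) (*-zeroʳ N))) (+-identityʳ (𝟙 (b zero)))
sum-pick {suc N} (suc x) b =
  trans (sum-cong-≗ λ i → cong (λ d → 𝟙 (d ∧ b (suc i))) (isYes-suc≟suc x i)) (sum-pick x (b ∘ suc))

sum-pick-one : ∀ {N} (x : Fin N) → sum (λ i → 𝟙 ⌊ x ≟ i ⌋) ≡ 1
sum-pick-one x =
  trans (sum-cong-≗ λ i → cong 𝟙 (sym (∧-identityʳ ⌊ x ≟ i ⌋))) (sum-pick x (λ _ → true))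

𝟙≤1 : ∀ b → 𝟙 b ≤ 1
𝟙≤1 true  = ≤-refl
𝟙≤1 false = z≤n

𝟙-∧≤ˡ : ∀ a b → 𝟙 (a ∧ b) ≤ 𝟙 a
𝟙-∧≤ˡ true  b = 𝟙≤1 b
𝟙-∧≤ˡ false b = z≤n

𝟙-∧≤ʳ : ∀ a b → 𝟙 (a ∧ b) ≤ 𝟙 b
𝟙-∧≤ʳ true  b = ≤-refl
𝟙-∧≤ʳ false b = z≤n

𝟙-supermodular : ∀ p q r s →
  𝟙 (p ∧ r) + 𝟙 (q ∧ s) ≤ 𝟙 ((p ∨ q) ∧ (r ∨ s)) + 𝟙 ((p ∧ q) ∧ (r ∧ s))
𝟙-supermodular true  true  true  true  = ≤ᵇ⇒≤ _ _ tt
𝟙-supermodular true  true  true  false = ≤ᵇ⇒≤ _ _ tt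
𝟙-supermodular true  true  false true  = ≤ᵇ⇒≤ _ _ tt
𝟙-supermodular true  true  false false = ≤ᵇ⇒≤ _ _ tt
𝟙-supermodular true  false true  true  = ≤ᵇ⇒≤ _ _ tt
𝟙-supermodular true  false true  false = ≤ᵇ⇒≤ _ _ tt
𝟙-supermodular true  false false true  = ≤ᵇ⇒≤ _ _ tt
𝟙-supermodular true  false false false = ≤ᵇ⇒≤ _ _ tt
𝟙-supermodular false true  true  true  = ≤ᵇ⇒≤ _ _ tt
𝟙-supermodular false true  true  false = ≤ᵇ⇒≤ _ _ tt
𝟙-supermodular false true  false true  = ≤ᵇ⇒≤ _ _ tt
𝟙-supermodular false true  false false = ≤ᵇ⇒≤ _ _ tt
𝟙-supermodular false false true  true  = ≤ᵇ⇒≤ _ _ tt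
𝟙-supermodular false false true  false = ≤ᵇ⇒≤ _ _ tt
𝟙-supermodular false false false true  = ≤ᵇ⇒≤ _ _ tt
𝟙-supermodular false false false false = ≤ᵇ⇒≤ _ _ tt

-- Weights of vertex sets

_↾_ : ∀ {n} → (Fin n → ℕ) → Subset n → Fin n → ℕ
(g ↾ A) v = if lookup A v then g v else 0

weight : ∀ {n} → (Fin n → ℕ) → Subset n → ℕ
weight g A = sum (g ↾ A)

weight-cong : ∀ {n} {g h : Fin n → ℕ} → (∀ v → g v ≡ h v) → ∀ A → weight g A ≡ weight h A
weight-cong g≗h A = sum-cong-≗ λ v → cong (if lookup A v then_else 0) (g≗h v)

weight-mono-≤ : ∀ {n} {g h : Fin n → ℕ} → (∀ v → g v ≤ h v) → ∀ A → weight g A ≤ weight h A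
weight-mono-≤ g≤h A = sum-mono-≤ λ v → restrict-mono (lookup A v) (g≤h v)
  where
  restrict-mono : ∀ a {x y} → x ≤ y → (if a then x else 0) ≤ (if a then y else 0)
  restrict-mono true  x≤y = x≤y
  restrict-mono false x≤y = z≤n

weight-+ : ∀ {n} (g h : Fin n → ℕ) A → weight (λ v → g v + h v) A ≡ weight g A + weight h A
weight-+ g h A = trans (sum-cong-≗ λ v → restrict-+ (lookup A v)) (∑-distrib-+ (g ↾ A) (h ↾ A))
  where
  restrict-+ : ∀ a {x y} → (if a then x + y else 0) ≡ (if a then x else 0) + (if a then y else 0)
  restrict-+ true  = refl
  restrict-+ false = refl

weight-const : ∀ {n} c (A : Subset n) → weight (λ _ → c) A ≡ c * ∣ A ∣
weight-const c []          = sym (*-zeroʳ c)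
weight-const c (true ∷ A)  = trans (cong (c +_) (weight-const c A)) (sym (*-suc c ∣ A ∣))
weight-const c (false ∷ A) = weight-const c A

weight-pick : ∀ {n} (x : Fin n) A → weight (λ v → 𝟙 ⌊ x ≟ v ⌋) A ≡ 𝟙 (lookup A x)
weight-pick x A = trans (sum-cong-≗ λ v → restrict-𝟙 ⌊ x ≟ v ⌋ (lookup A v)) (sum-pick x (lookup A))
  where
  restrict-𝟙 : ∀ b a → (if a then 𝟙 b else 0) ≡ 𝟙 (b ∧ a)
  restrict-𝟙 b true  = cong 𝟙 (sym (∧-identityʳ b))
  restrict-𝟙 b false = cong 𝟙 (sym (∧-zeroʳ b))

weight-⁅⁆ : ∀ {n} (g : Fin n → ℕ) x → weight g ⁅ x ⁆ ≡ g x
weight-⁅⁆ {suc n} g zero    = trans (cong (g zero +_) (weight-⊥ (g ∘ suc))) (+-identityʳ (g zero))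
  where
  weight-⊥ : ∀ {n} (g : Fin n → ℕ) → weight g ⊥ ≡ 0
  weight-⊥ {zero}  g = refl
  weight-⊥ {suc n} g = weight-⊥ (g ∘ suc)
weight-⁅⁆ {suc n} g (suc x) = weight-⁅⁆ (g ∘ suc) x

weight-modular : ∀ {n} (g : Fin n → ℕ) A B → weight g (A ∪ B) + weight g (A ∩ B) ≡ weight g A + weight g B
weight-modular g A B = begin
  weight g (A ∪ B) + weight g (A ∩ B)          ≡⟨ ∑-distrib-+ (g ↾ (A ∪ B)) (g ↾ (A ∩ B)) ⟨
  sum (λ v → (g ↾ (A ∪ B)) v + (g ↾ (A ∩ B)) v) ≡⟨ sum-cong-≗ per-vertex ⟩
  sum (λ v → (g ↾ A) v + (g ↾ B) v)            ≡⟨ ∑-distrib-+ (g ↾ A) (g ↾ B) ⟩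
  weight g A + weight g B                      ∎
  where
  open ≡-Reasoning
  restrict-modular : ∀ a b x → (if a ∨ b then x else 0) + (if a ∧ b then x else 0)
                                ≡ (if a then x else 0) + (if b then x else 0)
  restrict-modular true  true  x = refl
  restrict-modular true  false x = refl
  restrict-modular false true  x = +-comm x 0
  restrict-modular false false x = refl
  per-vertex : ∀ v → (g ↾ (A ∪ B)) v + (g ↾ (A ∩ B)) v ≡ (g ↾ A) v + (g ↾ B) v
  per-vertex v = trans (cong₂ (λ a b → (if a then g v else 0) + (if b then g v else 0))
                              (lookup-zipWith _∨_ v A B) (lookup-zipWith _∧_ v A B))
                       (restrict-modular (lookup A v) (lookup B v) (g v))

-- Out-degrees and spanned edges

outdeg : ∀ {n m} → Graph n m → Orientation m → Fin n → ℕ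
outdeg G o v = count (λ e → ⌊ tail G o e ≟ v ⌋)

sum-outdeg : ∀ {n m} (G : Graph n m) o → sum (outdeg G o) ≡ m
sum-outdeg {n} {zero} G o = trans (sum-const n 0) (*-zeroʳ n)
sum-outdeg {m = suc m} G o = begin
  sum (outdeg G o)
    ≡⟨ ∑-distrib-+ (λ v → 𝟙 ⌊ tail G o zero ≟ v ⌋) (outdeg (G ∘ suc) (o ∘ suc)) ⟩
  sum (λ v → 𝟙 ⌊ tail G o zero ≟ v ⌋) + sum (outdeg (G ∘ suc) (o ∘ suc))
    ≡⟨ cong₂ _+_ (sum-pick-one (tail G o zero)) (sum-outdeg (G ∘ suc) (o ∘ suc)) ⟩
  suc m ∎
  where open ≡-Reasoning

spanned-≤-weight-outdeg : ∀ {n m} (G : Graph n m) o A → spanned G A ≤ weight (outdeg G o) A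
spanned-≤-weight-outdeg {m = zero}  G o A = z≤n
spanned-≤-weight-outdeg {m = suc m} G o A = begin
  𝟙 (lookup A u ∧ lookup A w) + spanned (G ∘ suc) A
    ≤⟨ +-mono-≤ (spanned-edge≤tail (o zero)) (spanned-≤-weight-outdeg (G ∘ suc) (o ∘ suc) A) ⟩
  𝟙 (lookup A (tail G o zero)) + weight (outdeg (G ∘ suc) (o ∘ suc)) A
    ≡⟨ cong (_+ weight (outdeg (G ∘ suc) (o ∘ suc)) A) (weight-pick (tail G o zero) A) ⟨
  weight (λ v → 𝟙 ⌊ tail G o zero ≟ v ⌋) A + weight (outdeg (G ∘ suc) (o ∘ suc)) A
    ≡⟨ weight-+ _ (outdeg (G ∘ suc) (o ∘ suc)) A ⟨
  weight (outdeg G o) A ∎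
  where
  open ≤-Reasoning
  u = proj₁ (G zero)
  w = proj₂ (G zero)
  spanned-edge≤tail : ∀ β → 𝟙 (lookup A u ∧ lookup A w) ≤ 𝟙 (lookup A (if β then u else w))
  spanned-edge≤tail true  = 𝟙-∧≤ˡ (lookup A u) (lookup A w)
  spanned-edge≤tail false = 𝟙-∧≤ʳ (lookup A u) (lookup A w)

spanned-supermodular : ∀ {n m} (G : Graph n m) A B →
  spanned G A + spanned G B ≤ spanned G (A ∪ B) + spanned G (A ∩ B)
spanned-supermodular {m = m} G A B = begin
  spanned G A + spanned G B
    ≡⟨ cong₂ _+_ (count-as-sum (spans A)) (count-as-sum (spans B)) ⟩
  sum (𝟙 ∘ spans A) + sum (𝟙 ∘ spans B)
    ≡⟨ ∑-distrib-+ (𝟙 ∘ spans A) (𝟙 ∘ spans B) ⟨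
  sum (λ e → 𝟙 (spans A e) + 𝟙 (spans B e))
    ≤⟨ sum-mono-≤ per-edge ⟩
  sum (λ e → 𝟙 (spans (A ∪ B) e) + 𝟙 (spans (A ∩ B) e))
    ≡⟨ ∑-distrib-+ (𝟙 ∘ spans (A ∪ B)) (𝟙 ∘ spans (A ∩ B)) ⟩
  sum (𝟙 ∘ spans (A ∪ B)) + sum (𝟙 ∘ spans (A ∩ B))
    ≡⟨ cong₂ _+_ (count-as-sum (spans (A ∪ B))) (count-as-sum (spans (A ∩ B))) ⟨
  spanned G (A ∪ B) + spanned G (A ∩ B) ∎
  where
  open ≤-Reasoning
  spans : Subset _ → Fin m → Bool
  spans C e = lookup C (proj₁ (G e)) ∧ lookup C (proj₂ (G e))
  per-edge : ∀ e → 𝟙 (spans A e) + 𝟙 (spans B e) ≤ 𝟙 (spans (A ∪ B) e) + 𝟙 (spans (A ∩ B) e)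
  per-edge e rewrite lookup-zipWith _∨_ (proj₁ (G e)) A B | lookup-zipWith _∨_ (proj₂ (G e)) A B
                   | lookup-zipWith _∧_ (proj₁ (G e)) A B | lookup-zipWith _∧_ (proj₂ (G e)) A B =
    𝟙-supermodular (lookup A (proj₁ (G e))) (lookup B (proj₁ (G e)))
                   (lookup A (proj₂ (G e))) (lookup B (proj₂ (G e)))

module _ {n m ℓ} (G : Graph n m) (H : Graph n ℓ) where

  spanned-≤-addEdges : ∀ A → spanned G A ≤ spanned (addEdges G H) A
  spanned-≤-addEdges A = begin
    spanned G A                                                  ≡⟨ count-cong edge-↑ˡ ⟨
    count (λ e → spans (e ↑ˡ ℓ))                                 ≤⟨ m≤m+n _ _ ⟩
    count (λ e → spans (e ↑ˡ ℓ)) + count (λ e → spans (m ↑ʳ e)) ≡⟨ count-split m spans ⟨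
    spanned (addEdges G H) A                                     ∎
    where
    open ≤-Reasoning
    spans : Fin (m + ℓ) → Bool
    spans e = lookup A (proj₁ (addEdges G H e)) ∧ lookup A (proj₂ (addEdges G H e))
    edge-↑ˡ : ∀ e → spans (e ↑ˡ ℓ) ≡ lookup A (proj₁ (G e)) ∧ lookup A (proj₂ (G e))
    edge-↑ˡ e rewrite splitAt-↑ˡ m e ℓ = refl

  outdeg-addEdges : ∀ o o′ v → outdeg (addEdges G H) (o ++ o′) v ≡ outdeg G o v + outdeg H o′ v
  outdeg-addEdges o o′ v = trans (count-split m _) (cong₂ _+_ (count-cong tail-↑ˡ) (count-cong tail-↑ʳ))
    where
    tail-↑ˡ : ∀ e → ⌊ tail (addEdges G H) (o ++ o′) (e ↑ˡ ℓ) ≟ v ⌋ ≡ ⌊ tail G o e ≟ v ⌋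
    tail-↑ˡ e rewrite splitAt-↑ˡ m e ℓ = refl
    tail-↑ʳ : ∀ e → ⌊ tail (addEdges G H) (o ++ o′) (m ↑ʳ e) ≟ v ⌋ ≡ ⌊ tail H o′ e ≟ v ⌋
    tail-↑ʳ e rewrite splitAt-↑ʳ m ℓ e = refl

load : ∀ {n m k} → Graph n m → Orientation m → (Fin m → Fin k) → Fin n → Fin k → ℕ
load G o c v i = count (λ e → ⌊ c e ≟ i ⌋ ∧ ⌊ tail G o e ≟ v ⌋)

sum-load : ∀ {n m k} (G : Graph n m) (os : Fin k → Orientation m) (c : Fin m → Fin k) v →
  sum (λ i → load G (os i) c v i) ≡ outdeg G (λ e → os (c e) e) v
sum-load {m = zero} {k} G os c v = trans (sum-const k 0) (*-zeroʳ k)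
sum-load {m = suc m} G os c v = begin
  sum (λ i → load G (os i) c v i)
    ≡⟨ ∑-distrib-+ (λ i → 𝟙 (⌊ c zero ≟ i ⌋ ∧ ⌊ tail G (os i) zero ≟ v ⌋)) _ ⟩
  sum (λ i → 𝟙 (⌊ c zero ≟ i ⌋ ∧ ⌊ tail G (os i) zero ≟ v ⌋))
    + sum (λ i → load (G ∘ suc) (os i ∘ suc) (c ∘ suc) v i)
    ≡⟨ cong₂ _+_ (sum-pick (c zero) (λ i → ⌊ tail G (os i) zero ≟ v ⌋))
                 (sum-load (G ∘ suc) (λ i → os i ∘ suc) (c ∘ suc) v) ⟩
  outdeg G (λ e → os (c e) e) v ∎
  where open ≡-Reasoning

-- Slot assignments under Hall's condition

Slots : ℕ → ℕ → Set
Slots n k = Fin n → Fin k → Bool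

capacity : ∀ {n k} → Slots n k → Fin n → ℕ
capacity S v = count (S v)

HallCondition : ∀ {n m k} → Graph n m → Slots n k → Set
HallCondition G S = ∀ A → spanned G A ≤ weight (capacity S) A

record SlotAssignment {n m} k (G : Graph n m) (S : Slots n k) : Set where
  constructor assign
  field
    orientation : Orientation m
    colour      : Fin m → Fin k
    load≤slot   : ∀ v i → load G orientation colour v i ≤ 𝟙 (S v i)

without : ∀ {n k} → Slots n k → Fin n → Fin k → Slots n k
without S x i v j = not (⌊ i ≟ j ⌋ ∧ ⌊ x ≟ v ⌋) ∧ S v j

module _ {n k} (S : Slots n k) {x i} (Sxi : S x i ≡ true) where

  𝟙-without : ∀ v j → 𝟙 (S v j) ≡ 𝟙 (⌊ i ≟ j ⌋ ∧ ⌊ x ≟ v ⌋) + 𝟙 (without S x i v j)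
  𝟙-without v j with i ≟ j | x ≟ v
  ... | yes refl | yes refl rewrite Sxi = refl
  ... | yes _    | no _     = refl
  ... | no _     | _        = refl

  capacity-without : ∀ v → capacity S v ≡ 𝟙 ⌊ x ≟ v ⌋ + capacity (without S x i) v
  capacity-without v = begin
    capacity S v
      ≡⟨ count-as-sum (S v) ⟩
    sum (λ j → 𝟙 (S v j))
      ≡⟨ sum-cong-≗ (𝟙-without v) ⟩
    sum (λ j → 𝟙 (⌊ i ≟ j ⌋ ∧ ⌊ x ≟ v ⌋) + 𝟙 (without S x i v j))
      ≡⟨ ∑-distrib-+ (λ j → 𝟙 (⌊ i ≟ j ⌋ ∧ ⌊ x ≟ v ⌋)) (𝟙 ∘ without S x i v) ⟩
    sum (λ j → 𝟙 (⌊ i ≟ j ⌋ ∧ ⌊ x ≟ v ⌋)) + sum (λ j → 𝟙 (without S x i v j))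
      ≡⟨ cong₂ _+_ (sum-pick i (λ _ → ⌊ x ≟ v ⌋)) (sym (count-as-sum (without S x i v))) ⟩
    𝟙 ⌊ x ≟ v ⌋ + capacity (without S x i) v ∎
    where open ≡-Reasoning

  weight-capacity-without : ∀ A → weight (capacity S) A ≡ 𝟙 (lookup A x) + weight (capacity (without S x i)) A
  weight-capacity-without A = begin
    weight (capacity S) A
      ≡⟨ weight-cong capacity-without A ⟩
    weight (λ v → 𝟙 ⌊ x ≟ v ⌋ + capacity S′ v) A
      ≡⟨ weight-+ (λ v → 𝟙 ⌊ x ≟ v ⌋) (capacity S′) A ⟩
    weight (λ v → 𝟙 ⌊ x ≟ v ⌋) A + weight (capacity S′) A
      ≡⟨ cong (_+ weight (capacity S′) A) (weight-pick x A) ⟩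
    𝟙 (lookup A x) + weight (capacity S′) A ∎
    where
    open ≡-Reasoning
    S′ = without S x i

endpoint : ∀ {n m} → Graph n (suc m) → Bool → Fin n
endpoint G β = tail G (λ _ → β) zero

-- Under Hall's condition the inequality is an equality: x has no spare slot in A.
Tight : ∀ {n m k} → Graph n m → Slots n k → Fin n → Set
Tight {n} G S x = Σ (Subset n) λ A → x ∈ A × weight (capacity S) A ≤ spanned G A

hall-tail : ∀ {n m k} (G : Graph n (suc m)) (S : Slots n k) → HallCondition G S → HallCondition (G ∘ suc) S
hall-tail G S hall A = ≤-trans (m≤n+m _ _) (hall A)

place-first-edge : ∀ {n m k} (G : Graph n (suc m)) (S : Slots n k) β {i} → S (endpoint G β) i ≡ true →
  SlotAssignment k (G ∘ suc) (without S (endpoint G β) i) → SlotAssignment k G S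
place-first-edge G S β {i} Sxi (assign o c load≤slot) = assign (β Vector.∷ o) (i Vector.∷ c) λ v j → begin
  𝟙 (⌊ i ≟ j ⌋ ∧ ⌊ endpoint G β ≟ v ⌋) + load (G ∘ suc) o c v j
    ≤⟨ +-monoʳ-≤ (𝟙 (⌊ i ≟ j ⌋ ∧ ⌊ endpoint G β ≟ v ⌋)) (load≤slot v j) ⟩
  𝟙 (⌊ i ≟ j ⌋ ∧ ⌊ endpoint G β ≟ v ⌋) + 𝟙 (without S (endpoint G β) i v j)
    ≡⟨ 𝟙-without S Sxi v j ⟨
  𝟙 (S v j) ∎
  where open ≤-Reasoning

violator-tight : ∀ {n m k} (G : Graph n m) (S : Slots n k) → HallCondition G S → ∀ {x i} → S x i ≡ true →
  ∀ A → weight (capacity (without S x i)) A < spanned G A → Tight G S x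
violator-tight G S hall {x} {i} Sxi A violated with lookup A x in x∈A | weight-capacity-without S Sxi A
... | true  | capacity-split = A , lookup⇒[]= x A x∈A , ≤-trans (≤-reflexive capacity-split) violated
... | false | capacity-split = ⊥-elim (<⇒≱ violated (≤-trans (hall A) (≤-reflexive capacity-split)))

orient-first-edge : ∀ {n m k} (G : Graph n (suc m)) (S : Slots n k) → HallCondition G S →
  (∀ S′ → HallCondition (G ∘ suc) S′ → SlotAssignment k (G ∘ suc) S′) →
  ∀ β → SlotAssignment k G S ⊎ Tight (G ∘ suc) S (endpoint G β)
orient-first-edge G S hall recurse β with count≡0⊎∃ (S (endpoint G β))
... | inj₁ no-slot =
  inj₂ (⁅ endpoint G β ⁆ , x∈⁅x⁆ (endpoint G β) ,
        ≤-trans (≤-reflexive (trans (weight-⁅⁆ (capacity S) (endpoint G β)) no-slot)) z≤n)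
... | inj₂ (i , Sxi) with anySubset? (λ A → weight (capacity (without S (endpoint G β) i)) A <? spanned (G ∘ suc) A)
...   | yes (A , violated) = inj₂ (violator-tight (G ∘ suc) S (hall-tail G S hall) Sxi A violated)
...   | no no-violation    =
  inj₁ (place-first-edge G S β Sxi (recurse _ λ A → ≮⇒≥ λ violated → no-violation (A , violated)))

no-two-tight : ∀ {n m k} (G : Graph n (suc m)) (S : Slots n k) → HallCondition G S →
  Tight (G ∘ suc) S (endpoint G true) → Tight (G ∘ suc) S (endpoint G false) → Empty
no-two-tight G S hall (A , u∈A , A-tight) (B , w∈B , B-tight) = <⇒≱ U-overfull U-tight
  where
  G′ = G ∘ suc
  cap = weight (capacity S)
  U-tight : cap (A ∪ B) ≤ spanned G′ (A ∪ B)
  U-tight = +-cancelʳ-≤ (cap (A ∩ B)) (cap (A ∪ B)) (spanned G′ (A ∪ B)) (begin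
    cap (A ∪ B) + cap (A ∩ B)                 ≡⟨ weight-modular (capacity S) A B ⟩
    cap A + cap B                             ≤⟨ +-mono-≤ A-tight B-tight ⟩
    spanned G′ A + spanned G′ B               ≤⟨ spanned-supermodular G′ A B ⟩
    spanned G′ (A ∪ B) + spanned G′ (A ∩ B)   ≤⟨ +-monoʳ-≤ _ (hall-tail G S hall (A ∩ B)) ⟩
    spanned G′ (A ∪ B) + cap (A ∩ B)          ∎)
    where open ≤-Reasoning
  U-overfull : spanned G′ (A ∪ B) < cap (A ∪ B)
  U-overfull = subst (λ b → 𝟙 b + spanned G′ (A ∪ B) ≤ cap (A ∪ B))
                     (cong₂ _∧_ ([]=⇒lookup (x∈p∪q⁺ (inj₁ u∈A)))
                                ([]=⇒lookup (x∈p∪q⁺ {p = A} (inj₂ w∈B))))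
                     (hall (A ∪ B))

hall⇒slotAssignment : ∀ {n m k} (G : Graph n m) (S : Slots n k) → HallCondition G S → SlotAssignment k G S
hall⇒slotAssignment {m = zero}  G S _ = assign (λ ()) (λ ()) (λ _ _ → z≤n)
hall⇒slotAssignment {m = suc m} G S hall
  with orient-first-edge G S hall (hall⇒slotAssignment (G ∘ suc)) true
... | inj₁ α = α
... | inj₂ u-tight with orient-first-edge G S hall (hall⇒slotAssignment (G ∘ suc)) false
...   | inj₁ α       = α
...   | inj₂ w-tight = ⊥-elim (no-two-tight G S hall u-tight w-tight)

-- Sparsity, orientations and k-maps

allSlots : ∀ {n k} → Slots n k
allSlots _ _ = true

count-true : ∀ k → count {k} (λ _ → true) ≡ k
count-true zero    = refl
count-true (suc k) = cong suc (count-true k)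

sparse⇒slotAssignment : ∀ {n m} k (G : Graph n m) → Sparse k 0 G → SlotAssignment k G allSlots
sparse⇒slotAssignment k G sparse = hall⇒slotAssignment G allSlots λ A → begin
  spanned G A                          ≡⟨ +-identityʳ (spanned G A) ⟨
  spanned G A + 0                      ≤⟨ sparse A ⟩
  k * ∣ A ∣                            ≡⟨ weight-const k A ⟨
  weight (λ _ → k) A                   ≡⟨ weight-cong (λ _ → count-true k) A ⟨
  weight (capacity {k = k} allSlots) A ∎
  where open ≤-Reasoning

outdeg≤⇒sparse : ∀ {n m} k (G : Graph n m) o → (∀ v → outdeg G o v ≤ k) → Sparse k 0 G
outdeg≤⇒sparse k G o outdeg≤k A = begin
  spanned G A + 0            ≡⟨ +-identityʳ (spanned G A) ⟩
  spanned G A                ≤⟨ spanned-≤-weight-outdeg G o A ⟩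
  weight (outdeg G o) A      ≤⟨ weight-mono-≤ outdeg≤k A ⟩
  weight (λ _ → k) A         ≡⟨ weight-const k A ⟩
  k * ∣ A ∣                  ∎
  where open ≤-Reasoning

slotAssignment⇒outdeg≤ : ∀ {n m} k (G : Graph n m) → (α : SlotAssignment k G allSlots) →
  ∀ v → outdeg G (SlotAssignment.orientation α) v ≤ k
slotAssignment⇒outdeg≤ k G (assign o c load≤1) v = begin
  outdeg G o v                    ≡⟨ sum-load G (λ _ → o) c v ⟨
  sum (λ i → load G o c v i)      ≤⟨ sum-bounded (λ i → load G o c v i) (load≤1 v) ⟩
  k * 1                           ≡⟨ *-identityʳ k ⟩
  k                               ∎
  where open ≤-Reasoning

sparse⇒orientation : ∀ {n m} k (G : Graph n m) → Sparse k 0 G → ∃ λ o → ∀ v → outdeg G o v ≤ k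
sparse⇒orientation k G sparse = SlotAssignment.orientation α , slotAssignment⇒outdeg≤ k G α
  where α = sparse⇒slotAssignment k G sparse

sparse⇒kMap : ∀ {n m} k (G : Graph n m) → Sparse k 0 G → m ≡ k * n → IsKMap k G
sparse⇒kMap {n} {m} k G sparse m≡kn = colour , λ i → orientation , λ v → load≡1 v i
  where
  α = sparse⇒slotAssignment k G sparse
  open SlotAssignment α
  outdeg≡k : ∀ v → outdeg G orientation v ≡ k
  outdeg≡k = sum-saturated (outdeg G orientation) (slotAssignment⇒outdeg≤ k G α)
    (≤-reflexive (trans (*-comm n k) (trans (sym m≡kn) (sym (sum-outdeg G orientation)))))
  load≡1 : ∀ v i → load G orientation colour v i ≡ 1
  load≡1 v = sum-saturated (λ i → load G orientation colour v i) (load≤slot v)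
    (≤-reflexive (trans (*-identityʳ k) (trans (sym (outdeg≡k v)) (sym (sum-load G (λ _ → orientation) colour v)))))

kMap⇒orientation : ∀ {n m} k (G : Graph n m) → IsKMap k G → ∃ λ o → ∀ v → outdeg G o v ≡ k
kMap⇒orientation k G (c , maps) = o , λ v → begin
  outdeg G o v                                      ≡⟨ sum-load G (proj₁ ∘ maps) c v ⟨
  sum (λ i → load G (proj₁ (maps i)) c v i)         ≡⟨ sum-cong-≗ (λ i → proj₂ (maps i) v) ⟩
  sum {k} (λ _ → 1)                                 ≡⟨ sum-const k 1 ⟩
  k * 1                                             ≡⟨ *-identityʳ k ⟩
  k                                                 ∎
  where
  open ≡-Reasoning
  o : Orientation _
  o e = proj₁ (maps (c e)) e

deficient-vertex : ∀ {n} k (d : Fin n → ℕ) → sum d < k * n → ∃ λ v → d v < k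
deficient-vertex {n} k d sum<kn with any? (λ v → d v <? k)
... | yes found = found
... | no none   = ⊥-elim (<⇒≱ sum<kn (begin
  k * n              ≡⟨ *-comm k n ⟩
  n * k              ≡⟨ sum-const n k ⟨
  sum {n} (λ _ → k)  ≤⟨ sum-mono-≤ (λ v → ≮⇒≥ λ dv<k → none (v , dv<k)) ⟩
  sum d              ∎))
  where open ≤-Reasoning

bump : ∀ {n} → Fin n → (Fin n → ℕ) → Fin n → ℕ
bump v d w = 𝟙 ⌊ v ≟ w ⌋ + d w

sum-bump : ∀ {n} (v : Fin n) d → sum (bump v d) ≡ suc (sum d)
sum-bump v d = trans (∑-distrib-+ (λ w → 𝟙 ⌊ v ≟ w ⌋) d) (cong (_+ sum d) (sum-pick-one v))

bump≤ : ∀ {n k} {v : Fin n} {d} → (∀ w → d w ≤ k) → d v < k → ∀ w → bump v d w ≤ k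
bump≤ {v = v} d≤k dv<k w with v ≟ w
... | yes refl = dv<k
... | no _     = d≤k w

loops-filling : ∀ {n} k ℓ (d : Fin n → ℕ) → (∀ v → d v ≤ k) → sum d + ℓ ≤ k * n →
  Σ (Graph n ℓ) λ H → ∀ v → d v + outdeg H (λ _ → true) v ≤ k
loops-filling k zero d d≤k _ = (λ ()) , λ v → subst (_≤ k) (sym (+-identityʳ (d v))) (d≤k v)
loops-filling k (suc ℓ) d d≤k room
  with deficient-vertex k d (<-≤-trans (m<m+n (sum d) z<s) room)
... | v , dv<k with loops-filling k ℓ (bump v d) (bump≤ d≤k dv<k) room′
  where
  room′ = ≤-trans (≤-reflexive (trans (cong (_+ ℓ) (sum-bump v d)) (sym (+-suc (sum d) ℓ)))) room
...   | H , fits = ((v , v) Vector.∷ H) , λ w → subst (_≤ k) (regroup (d w) (𝟙 ⌊ v ≟ w ⌋) _) (fits w)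
  where
  regroup : ∀ a b c → b + a + c ≡ a + (b + c)
  regroup a b c = trans (cong (_+ c) (+-comm b a)) (+-assoc a b c)

theorem2 : (k ℓ n m : ℕ) → 1 ≤ k → ℓ < 2 * k → (G : Graph n m) → m + ℓ ≡ k * n →
    (Sparse k 0 G ⇔ ∃ λ (H : Graph n ℓ) → IsKMap k (addEdges G H))
theorem2 k ℓ n m _ _ G m+ℓ≡kn = mk⇔ to from
  where
  to : Sparse k 0 G → ∃ λ (H : Graph n ℓ) → IsKMap k (addEdges G H)
  to sparse with sparse⇒orientation k G sparse
  ... | o , outdeg≤k with loops-filling k ℓ (outdeg G o) outdeg≤k room
    where room = ≤-reflexive (trans (cong (_+ ℓ) (sum-outdeg G o)) m+ℓ≡kn)
  ...   | H , fits = H , sparse⇒kMap k (addEdges G H) (outdeg≤⇒sparse k (addEdges G H) o′ padded) m+ℓ≡kn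
    where
    o′ = o ++ λ _ → true
    padded : ∀ v → outdeg (addEdges G H) o′ v ≤ k
    padded v = subst (_≤ k) (sym (outdeg-addEdges G H o _ v)) (fits v)
  from : (∃ λ (H : Graph n ℓ) → IsKMap k (addEdges G H)) → Sparse k 0 G
  from (H , kMap) A with kMap⇒orientation k (addEdges G H) kMap
  ... | o , outdeg≡k = ≤-trans (+-monoˡ-≤ 0 (spanned-≤-addEdges G H A))
                               (outdeg≤⇒sparse k (addEdges G H) o (≤-reflexive ∘ outdeg≡k) A)
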